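{- Let $k\ge1$ and let $\mathbf c^{(0)},\dots,\mathbf c^{(k)}$ be compositions with $\mathbf c^{(k)}\ne\epsilon$. Then for every permutation $\sigma\in\mathcal S_{k-1}$, $$\mathrm P\big(\mathbf c^{(0)}\oplus(3)\oplus\mathbf c^{(1)}\oplus(3)\oplus\cdots\oplus(3)\oplus\mathbf c^{(k)}\big)=\mathrm P\big(\mathbf c^{(0)}\oplus(3)\oplus\mathbf c^{(\sigma_1)}\oplus(3)\oplus\cdots\oplus\mathbf c^{(\sigma_{k-1})}\oplus(3)\oplus\mathbf c^{(k)}\big).$$
   Context: Permutations $\sigma\in\mathcal S_n$ are words $\sigma_1\cdots\sigma_n$; $i$ is a peak if $\sigma_{i-1}<\sigma_i>\sigma_{i+1}$. A composition of $n$ is a finite sequence of positive integers summing to $n$; $\epsilon$ is the empty composition. If the peak set of $\sigma\in\mathcal S_n$ is $\{i_1<\dots<i_k\}$, its peak-composition is $(c_1,\dots,c_{k+1})$, $c_j=i_j-i_{j-1}$, $i_0=0$, $i_{k+1}=n$. $\mathrm P(\mathbf c)$ is the number of permutations of $\{1,\dots,\text{size of }\mathbf c\}$ with peak-composition $\mathbf c$. $\oplus$ is concatenation with identity $\epsilon$. -}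

module Defs where

open import Data.Nat using (ℕ; zero; suc; _∸_; _<_; _<?_)
open import Data.Nat.Properties using (_≟_)
open import Data.List using (List; []; _∷_; _++_; [_]; map; concatMap; filter; length; upTo; allFin)
open import Data.Nat.ListAction using (sum)
open import Data.List.Properties using (≡-dec)
open import Data.List.Relation.Unary.Unique.DecPropositional _≟_ using (unique?)
open import Data.Fin using (Fin)
open import Relation.Nullary using (does)
open import Data.Bool using (_∧_; if_then_else_)

-- A permutation of {1,…,n} is represented as a word σ₁⋯σₙ (a list of ℕ).
-- Words of length l with letters in {1,…,n}:
words : ℕ → ℕ → List (List ℕ)
words n zero    = [] ∷ []
words n (suc l) = concatMap (λ x → map (x ∷_) (words n l)) (map suc (upTo n))

perms : ℕ → List (List ℕ)
perms n = filter unique? (words n n)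

-- Peak positions (1-indexed, increasing) of a word; the argument i is the
-- 1-indexed position of the head of the list.
peaksFrom : ℕ → List ℕ → List ℕ
peaksFrom i (a ∷ b ∷ c ∷ rest) =
  (if does (a <? b) ∧ does (c <? b) then [ suc i ] else [])
  ++ peaksFrom (suc i) (b ∷ c ∷ rest)
peaksFrom i _ = []

peakSet : List ℕ → List ℕ
peakSet w = peaksFrom 1 w

diffs : ℕ → List ℕ → ℕ → List ℕ
diffs prev []       n = (n ∸ prev) ∷ []
diffs prev (p ∷ ps) n = (p ∸ prev) ∷ diffs p ps n

peakComp : List ℕ → List ℕ
peakComp w = diffs 0 (peakSet w) (length w)

P : List ℕ → ℕ
P c = length (filter (λ w → ≡-dec _≟_ (peakComp w) c) (perms (sum c)))

open import Data.List.Relation.Unary.All using (All)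
IsComposition : List ℕ → Set
IsComposition c = All (λ x → 0 < x) c

-- c₀ ⊕ (3) ⊕ f(1) ⊕ (3) ⊕ ⋯ ⊕ f(m) ⊕ (3) ⊕ cₖ   (with f indexed by Fin m)
chain : ∀ {m} → List ℕ → (Fin m → List ℕ) → List ℕ → List ℕ
chain {m} c₀ f cₖ = c₀ ++ concatMap (λ i → 3 ∷ f i) (allFin m) ++ (3 ∷ cₖ)

module Submission where

-- Record the peaks of a word w by its peak indicator, the list
-- of booleans telling which positions are peaks.  For a nonempty composition c,
-- w has peak-composition c iff its indicator equals encode c (every part but the
-- last is closed by a peak), so P c counts the permutations with indicator
-- encode c.  For the chain c₀ ⊕ (3) ⊕ c¹ ⊕ ⋯ ⊕ (3) ⊕ cᵏ, each (3) contributes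
-- "non-peak, non-peak, peak"; cutting between its first two letters regroups
-- encode (chain …) as a block pattern initial ++ block 1 ++ ⋯ ++ final whose
-- pieces meet where the indicator reads "peak, non-peak | non-peak, peak".  At
-- such a cut the word itself descends and then ascends, so the cut creates no
-- peak and the indicator is local to the pieces.  Hence cutting a permutation
-- into words of the block lengths and reordering the middle words by σ is a
-- bijection between permutations with the pattern and those with the permuted
-- pattern, which is the permuted chain.

open import Defs
open import Data.Nat using (ℕ; zero; suc; _+_; _∸_; _<_; _<?_; _≤_; s≤s; z≤n)
open import Data.Nat.Properties
  using (_≟_; <-asym; +-identityʳ; +-suc; +-comm; m+n∸m≡n; suc-injective; <ᵇ⇒<; m≤m+n; m≤n⇒m⊓n≡m)
open import Data.Nat.ListAction using (sum)
open import Data.Nat.ListAction.Properties using (sum-↭)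
open import Data.Bool using (Bool; true; false; T; _∧_; if_then_else_)
open import Data.Bool.Properties using (∧-zeroʳ; T-∧) renaming (_≟_ to _≟ᵇ_)
open import Data.List
  using (List; []; _∷_; _++_; [_]; length; replicate; take; drop; map; concat; concatMap; allFin; tabulate;
         upTo; filter; cartesianProductWith)
open import Data.List.Properties
  using (++-assoc; ++-identityʳ; ++-conicalʳ; length-++; length-map; length-take; length-drop; ∷-injective;
         take++drop≡id; map-∘; ≡-dec; filter-≐)
open import Data.List.Membership.Propositional using (_∈_)
open import Data.List.Membership.Propositional.Properties
  using (∈-map⁺; ∈-map⁻; ∈-filter⁺; ∈-filter⁻; ∈-concat⁺′; ∈-concat⁻′; ∈-allFin)
open import Data.List.Membership.Propositional.Properties.WithK using (unique∧set⇒bag)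
open import Data.List.Relation.Unary.Any using (here; there)
open import Data.List.Relation.Unary.All as All using (All; []; _∷_)
import Data.List.Relation.Unary.All.Properties as AllProps
open import Data.List.Relation.Unary.AllPairs using ([]; _∷_)
open import Data.List.Relation.Unary.Unique.Propositional using (Unique)
import Data.List.Relation.Unary.Unique.Propositional.Properties as Unique
open import Data.List.Relation.Unary.Unique.DecPropositional _≟_ using (unique?)
open import Data.List.Relation.Binary.Permutation.Propositional
  using (_↭_; prep; swap; ↭-sym; ↭⇒↭ₛ) renaming (refl to ↭-refl; trans to ↭-trans)
open import Data.List.Relation.Binary.Permutation.Propositional.Properties
  using (All-resp-↭; ↭-length; ++⁺ˡ; ++⁺ʳ; shifts; map⁺)
open import Data.List.Relation.Binary.Permutation.Setoid.Properties using (Unique-resp-↭)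
open import Data.List.Relation.Binary.BagAndSetEquality using (∼bag⇒↭)
open import Data.Fin using (Fin; zero; suc; inject₁; fromℕ)
open import Data.Fin.Permutation using (Permutation′; _⟨$⟩ʳ_; _⟨$⟩ˡ_; inverseˡ; inverseʳ; flip)
open import Data.Product using (_×_; _,_; proj₁; proj₂; Σ-syntax)
open import Data.Sum using (_⊎_; inj₁; inj₂)
open import Data.Unit using (⊤; tt)
open import Function using (_∘_; _⇔_; mk⇔; Equivalence)
open import Relation.Nullary using (does; contradiction)
open import Relation.Nullary.Decidable using (dec-false)
open import Relation.Binary.PropositionalEquality
  using (_≡_; _≢_; refl; sym; trans; cong; cong₂; subst; subst₂; setoid; module ≡-Reasoning)

peakAt : ℕ → ℕ → List ℕ → Bool
peakAt a b []      = false
peakAt a b (c ∷ _) = does (a <? b) ∧ does (c <? b)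

peaksAfter : ℕ → List ℕ → List Bool
peaksAfter a []      = []
peaksAfter a (b ∷ r) = peakAt a b r ∷ peaksAfter b r

indicator : List ℕ → List Bool
indicator []      = []
indicator (a ∷ r) = false ∷ peaksAfter a r

length-peaksAfter : ∀ a r → length (peaksAfter a r) ≡ length r
length-peaksAfter a []      = refl
length-peaksAfter a (b ∷ r) = cong suc (length-peaksAfter b r)

length-indicator : ∀ w → length (indicator w) ≡ length w
length-indicator []      = refl
length-indicator (a ∷ r) = cong suc (length-peaksAfter a r)

-- A nonempty list of parts, stored as (first part, remaining parts).
parts : ℕ × List ℕ → List ℕ
parts (x , r) = x ∷ r

-- decode k X reads a composition off an indicator X, when k letters have been
-- seen since the last peak: a part ends at every true and at the end of X.
decode : ℕ → List Bool → ℕ × List ℕ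
decode k []          = k , []
decode k (true ∷ X)  = suc k , parts (decode 0 X)
decode k (false ∷ X) = decode (suc k) X

∸-by-sum : ∀ {N prev k} → N ≡ prev + k → N ∸ prev ≡ k
∸-by-sum {prev = prev} {k} refl = m+n∸m≡n prev k

-- Invariant of the peak scan: if the suffix a ∷ r starts at position i, the last
-- peak before it is prev, and k = i − prev, then the remaining differences of the
-- peak set are the decoding of the indicator of r.
peakComp-suffix : ∀ prev k i N a r → i ≡ prev + k → N ≡ i + length r →
  diffs prev (peaksFrom i (a ∷ r)) N ≡ parts (decode k (peaksAfter a r))
peakComp-suffix prev k i N a [] i≡ N≡ =
  cong (_∷ []) (∸-by-sum (trans N≡ (trans (+-identityʳ i) i≡)))
peakComp-suffix prev k i N a (b ∷ []) i≡ N≡ =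
  cong (_∷ []) (∸-by-sum (trans N≡ (trans (+-suc i 0)
    (trans (cong suc (trans (+-identityʳ i) i≡)) (sym (+-suc prev k))))))
peakComp-suffix prev k i N a (b ∷ c ∷ r) i≡ N≡ =
  cases (does (a <? b) ∧ does (c <? b))
    (peakComp-suffix (suc i) 0 (suc i) N b (c ∷ r) (sym (+-identityʳ (suc i))) N≡′)
    (peakComp-suffix prev (suc k) (suc i) N b (c ∷ r) i+1≡ N≡′)
  where
  i+1≡ : suc i ≡ prev + suc k
  i+1≡ = trans (cong suc i≡) (sym (+-suc prev k))
  N≡′ : N ≡ suc i + length (c ∷ r)
  N≡′ = trans N≡ (+-suc i _)
  cases : ∀ β {ps X} → diffs (suc i) ps N ≡ parts (decode 0 X) →
          diffs prev ps N ≡ parts (decode (suc k) X) →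
          diffs prev ((if β then [ suc i ] else []) ++ ps) N ≡ parts (decode k (β ∷ X))
  cases true  new-part _    = cong₂ _∷_ (∸-by-sum i+1≡) new-part
  cases false _    same-part = same-part

peakComp≡decode : ∀ w → peakComp w ≡ parts (decode 0 (indicator w))
peakComp≡decode []      = refl
peakComp≡decode (a ∷ r) = peakComp-suffix 0 1 1 (suc (length r)) a r refl refl

closedPart : ℕ → List Bool
closedPart x = replicate (x ∸ 1) false ++ true ∷ []

encode : List ℕ → List Bool
encode []          = []
encode (x ∷ [])    = replicate x false
encode (x ∷ y ∷ r) = closedPart x ++ encode (y ∷ r)

decode-falses : ∀ k j X → decode k (replicate j false ++ X) ≡ decode (k + j) X
decode-falses k zero    X = cong (λ z → decode z X) (sym (+-identityʳ k))
decode-falses k (suc j) X = trans (decode-falses (suc k) j X) (cong (λ z → decode z X) (sym (+-suc k j)))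

encode-decode : ∀ k X → replicate k false ++ X ≡ encode (parts (decode k X))
encode-decode k []          = ++-identityʳ _
encode-decode k (true ∷ X)  = begin
  replicate k false ++ true ∷ X
    ≡⟨ cong (λ z → replicate k false ++ true ∷ z) (encode-decode 0 X) ⟩
  replicate k false ++ true ∷ encode (parts (decode 0 X))
    ≡⟨ ++-assoc (replicate k false) (true ∷ []) _ ⟨
  encode (parts (decode k (true ∷ X))) ∎
  where open ≡-Reasoning
encode-decode k (false ∷ X) = trans (shift k) (encode-decode (suc k) X)
  where
  shift : ∀ k → replicate k false ++ false ∷ X ≡ false ∷ replicate k false ++ X
  shift zero    = refl
  shift (suc k) = cong (false ∷_) (shift k)

decode-encode : ∀ k x r → IsComposition (x ∷ r) → decode k (encode (x ∷ r)) ≡ (k + x , r)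
decode-encode k x       []      _ =
  trans (cong (decode k) (sym (++-identityʳ (replicate x false)))) (decode-falses k x [])
decode-encode k (suc x) (y ∷ r) (_ ∷ pos) = begin
  decode k ((replicate x false ++ true ∷ []) ++ encode (y ∷ r))
    ≡⟨ cong (decode k) (++-assoc (replicate x false) _ _) ⟩
  decode k (replicate x false ++ true ∷ encode (y ∷ r))
    ≡⟨ decode-falses k x _ ⟩
  (suc (k + x) , parts (decode 0 (encode (y ∷ r))))
    ≡⟨ cong₂ _,_ (sym (+-suc k x)) (cong parts (decode-encode 0 y r pos)) ⟩
  (k + suc x , y ∷ r) ∎
  where open ≡-Reasoning

peakComp≡⇔indicator≡ : ∀ w c → IsComposition c → c ≢ [] → (peakComp w ≡ c) ⇔ (indicator w ≡ encode c)
peakComp≡⇔indicator≡ w c pos c≢[] = mk⇔ to (from c pos c≢[])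
  where
  to : peakComp w ≡ c → indicator w ≡ encode c
  to refl = trans (encode-decode 0 (indicator w)) (cong encode (sym (peakComp≡decode w)))
  from : ∀ c → IsComposition c → c ≢ [] → indicator w ≡ encode c → peakComp w ≡ c
  from []      _   c≢[] _ = contradiction refl c≢[]
  from (x ∷ r) pos _    e = begin
    peakComp w                          ≡⟨ peakComp≡decode w ⟩
    parts (decode 0 (indicator w))      ≡⟨ cong (λ X → parts (decode 0 X)) e ⟩
    parts (decode 0 (encode (x ∷ r)))   ≡⟨ cong parts (decode-encode 0 x r pos) ⟩
    x ∷ r                               ∎
    where open ≡-Reasoning

EndsFalling : List ℕ → Set
EndsFalling (a ∷ b ∷ [])    = b < a
EndsFalling (a ∷ b ∷ c ∷ r) = EndsFalling (b ∷ c ∷ r)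
EndsFalling _               = ⊤

StartsRising : List ℕ → Set
StartsRising (a ∷ b ∷ _) = a < b
StartsRising _           = ⊤

below-left⇒¬peak : ∀ {a b c} → b < a → does (a <? b) ∧ does (c <? b) ≡ false
below-left⇒¬peak {a} {b} b<a rewrite dec-false (a <? b) (<-asym b<a) = refl

below-right⇒¬peak : ∀ {a b c} → b < c → does (a <? b) ∧ does (c <? b) ≡ false
below-right⇒¬peak {a} {b} {c} b<c rewrite dec-false (c <? b) (<-asym b<c) = ∧-zeroʳ (does (a <? b))

peak-conditions : ∀ {a b c} → does (a <? b) ∧ does (c <? b) ≡ true → a < b × c < b
peak-conditions {a} {b} {c} e = <ᵇ⇒< a b (proj₁ both) , <ᵇ⇒< c b (proj₂ both)
  where
  both : T (does (a <? b)) × T (does (c <? b))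
  both = Equivalence.to (T-∧ {does (a <? b)} {does (c <? b)}) (subst T (sym e) tt)

-- Gluing a falling word to a rising word creates no peak at the junction, so
-- the indicator of the concatenation is the concatenation of the indicators.
peaksAfter-++ : ∀ a u v → EndsFalling (a ∷ u) → StartsRising v →
  peaksAfter a (u ++ v) ≡ peaksAfter a u ++ indicator v
peaksAfter-++ a []          []          _   _   = refl
peaksAfter-++ a []          (b ∷ [])    _   _   = refl
peaksAfter-++ a []          (b ∷ c ∷ r) _   b<c = cong (_∷ peaksAfter b (c ∷ r)) (below-right⇒¬peak b<c)
peaksAfter-++ a (b ∷ [])    []          _   _   = refl
peaksAfter-++ a (b ∷ [])    (c ∷ r)     b<a rv  =
  cong₂ _∷_ (below-left⇒¬peak b<a) (peaksAfter-++ b [] (c ∷ r) tt rv)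
peaksAfter-++ a (b ∷ c ∷ u) v           fu  rv  =
  cong (does (a <? b) ∧ does (c <? b) ∷_) (peaksAfter-++ b (c ∷ u) v fu rv)

indicator-++ : ∀ u v → EndsFalling u → StartsRising v → indicator (u ++ v) ≡ indicator u ++ indicator v
indicator-++ []      v _  _  = refl
indicator-++ (a ∷ u) v fu rv = cong (false ∷_) (peaksAfter-++ a u v fu rv)

-- Conversely, a peak at the second letter of v in u ++ v forces v to start rising …
peaksAfter⇒startsRising : ∀ a u v A B → length A ≡ length u →
  peaksAfter a (u ++ v) ≡ A ++ false ∷ true ∷ B → StartsRising v
peaksAfter⇒startsRising a []      (b ∷ c ∷ d ∷ r) [] B _ e =
  proj₁ (peak-conditions (proj₁ (∷-injective (proj₂ (∷-injective e)))))
peaksAfter⇒startsRising a (b ∷ u) v (x ∷ A) B l e =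
  peaksAfter⇒startsRising b u v A B (suc-injective l) (proj₂ (∷-injective e))
peaksAfter⇒startsRising a []      []              []      B _  ()
peaksAfter⇒startsRising a []      (b ∷ [])        []      B _  ()
peaksAfter⇒startsRising a []      (b ∷ c ∷ [])    []      B _  ()
peaksAfter⇒startsRising a []      v               (x ∷ A) B () _
peaksAfter⇒startsRising a (b ∷ u) v               []      B () _

indicator⇒startsRising : ∀ u v A B → length A ≡ length u →
  indicator (u ++ v) ≡ A ++ false ∷ true ∷ B → StartsRising v
indicator⇒startsRising []      (b ∷ c ∷ d ∷ r) [] B _ e =
  proj₁ (peak-conditions (proj₁ (∷-injective (proj₂ (∷-injective e)))))
indicator⇒startsRising (a ∷ u) v (x ∷ A) B l e =
  peaksAfter⇒startsRising a u v A B (suc-injective l) (proj₂ (∷-injective e))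
indicator⇒startsRising []      []              []      B _  ()
indicator⇒startsRising []      (b ∷ [])        []      B _  ()
indicator⇒startsRising []      (b ∷ c ∷ [])    []      B _  ()
indicator⇒startsRising []      v               (x ∷ A) B () _
indicator⇒startsRising (a ∷ u) v               []      B () _

-- … and a peak at the second-to-last letter of u forces u to end falling.
peaksAfter⇒endsFalling : ∀ a u v Y B → length u ≡ 2 + length Y →
  peaksAfter a (u ++ v) ≡ (Y ++ true ∷ false ∷ []) ++ B → EndsFalling (a ∷ u)
peaksAfter⇒endsFalling a (b ∷ c ∷ [])    v []      B _ e = proj₂ (peak-conditions (proj₁ (∷-injective e)))
peaksAfter⇒endsFalling a (b ∷ c ∷ d ∷ u) v (y ∷ Y) B l e =
  peaksAfter⇒endsFalling b (c ∷ d ∷ u) v Y B (suc-injective l) (proj₂ (∷-injective e))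
peaksAfter⇒endsFalling a []              v Y       B () _
peaksAfter⇒endsFalling a (b ∷ [])        v []      B () _
peaksAfter⇒endsFalling a (b ∷ [])        v (y ∷ Y) B () _
peaksAfter⇒endsFalling a (b ∷ c ∷ [])    v (y ∷ Y) B () _
peaksAfter⇒endsFalling a (b ∷ c ∷ d ∷ u) v []      B () _

indicator⇒endsFalling : ∀ u v Y B → length u ≡ 2 + length Y →
  indicator (u ++ v) ≡ (Y ++ true ∷ false ∷ []) ++ B → EndsFalling u
indicator⇒endsFalling (a ∷ u) v (y ∷ Y) B l e =
  peaksAfter⇒endsFalling a u v Y B (suc-injective l) (proj₂ (∷-injective e))
indicator⇒endsFalling (a ∷ u) v []      B l ()
indicator⇒endsFalling []      v Y       B () _

-- Indicator blocks that can stand at the right (Opens: no peak at the first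
-- letter, a peak at the second) or at the left (Closes: a peak at the
-- second-to-last letter, none at the last; or a single non-peak) of a junction.
Opens : List Bool → Set
Opens X = Σ[ X′ ∈ List Bool ] X ≡ false ∷ true ∷ X′

Closes : List Bool → Set
Closes X = X ≡ false ∷ [] ⊎ Σ[ Y ∈ List Bool ] X ≡ Y ++ true ∷ false ∷ []

Opens-++ : ∀ X Y → Opens X → Opens (X ++ Y)
Opens-++ _ Y (X′ , refl) = X′ ++ Y , refl

endsFalling-at-cut : ∀ u v A B → length u ≡ length A → Closes A →
  indicator (u ++ v) ≡ A ++ B → EndsFalling u
endsFalling-at-cut (a ∷ [])     v _ B _ (inj₁ refl) _ = tt
endsFalling-at-cut []           v _ B () (inj₁ refl) _
endsFalling-at-cut (a ∷ b ∷ u)  v _ B () (inj₁ refl) _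
endsFalling-at-cut u v _ B l (inj₂ (Y , refl)) e =
  indicator⇒endsFalling u v Y B (trans l (trans (length-++ Y) (+-comm (length Y) 2))) e

startsRising-at-cut : ∀ u v A B → length u ≡ length A → Opens B →
  indicator (u ++ v) ≡ A ++ B → StartsRising v
startsRising-at-cut u v A _ l (B′ , refl) e = indicator⇒startsRising u v A B′ (sym l) e

++-cancel-equal-length : ∀ {A : Set} (xs ys : List A) {zs ws} → length xs ≡ length ys →
  xs ++ zs ≡ ys ++ ws → xs ≡ ys × zs ≡ ws
++-cancel-equal-length []       []       _ e = refl , e
++-cancel-equal-length (x ∷ xs) (y ∷ ys) l e with ∷-injective e
... | refl , e′ with ++-cancel-equal-length xs ys (suc-injective l) e′
...   | refl , e″ = refl , e″

indicator-split : ∀ u v A B → length u ≡ length A → Closes A → Opens B →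
  indicator (u ++ v) ≡ A ++ B → indicator u ≡ A × indicator v ≡ B
indicator-split u v A B l cA oB e =
  ++-cancel-equal-length (indicator u) A (trans (length-indicator u) l)
    (trans (sym (indicator-++ u v (endsFalling-at-cut u v A B l cA e) (startsRising-at-cut u v A B l oB e))) e)

indicator-join : ∀ u v → Closes (indicator u) → Opens (indicator v) →
  indicator (u ++ v) ≡ indicator u ++ indicator v
indicator-join u v cu ov = indicator-++ u v (falls u cu) (rises v ov)
  where
  falls : ∀ u → Closes (indicator u) → EndsFalling u
  falls u cu = endsFalling-at-cut u [] (indicator u) [] (sym (length-indicator u)) cu
    (trans (cong indicator (++-identityʳ u)) (sym (++-identityʳ (indicator u))))
  rises : ∀ v → Opens (indicator v) → StartsRising v
  rises v ov = startsRising-at-cut [] v [] (indicator v) refl ov refl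

concatᶠ : ∀ {A : Set} {m} → (Fin m → List A) → List A
concatᶠ {m = zero}  B = []
concatᶠ {m = suc m} B = B zero ++ concatᶠ (B ∘ suc)

concatᶠ-cong : ∀ {A : Set} {m} {B B′ : Fin m → List A} → (∀ i → B i ≡ B′ i) → concatᶠ B ≡ concatᶠ B′
concatᶠ-cong {m = zero}  e = refl
concatᶠ-cong {m = suc m} e = cong₂ _++_ (e zero) (concatᶠ-cong (e ∘ suc))

concatMap-tabulate : ∀ {A B : Set} {m} (g : A → List B) (h : Fin m → A) →
  concatMap g (tabulate h) ≡ concatᶠ (g ∘ h)
concatMap-tabulate {m = zero}  g h = refl
concatMap-tabulate {m = suc m} g h = cong (g (h zero) ++_) (concatMap-tabulate g (h ∘ suc))

concatMap-allFin : ∀ {B : Set} {m} (g : Fin m → List B) → concatMap g (allFin m) ≡ concatᶠ g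
concatMap-allFin g = concatMap-tabulate g (λ i → i)

concat-↭ : ∀ {A : Set} {xss yss : List (List A)} → xss ↭ yss → concat xss ↭ concat yss
concat-↭ ↭-refl         = ↭-refl
concat-↭ (prep xs p)    = ++⁺ˡ xs (concat-↭ p)
concat-↭ (swap xs ys p) = ↭-trans (shifts xs ys) (++⁺ˡ ys (++⁺ˡ xs (concat-↭ p)))
concat-↭ (↭-trans p q)  = ↭-trans (concat-↭ p) (concat-↭ q)

allFin-↭ : ∀ {m} (σ : Permutation′ m) → map (σ ⟨$⟩ʳ_) (allFin m) ↭ allFin m
allFin-↭ {m} σ = ∼bag⇒↭ (unique∧set⇒bag
  (Unique.map⁺ (λ e → trans (sym (inverseˡ σ)) (trans (cong (σ ⟨$⟩ˡ_) e) (inverseˡ σ))) (Unique.allFin⁺ m))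
  (Unique.allFin⁺ m)
  (λ {i} → mk⇔ (λ _ → ∈-allFin _)
     (λ _ → subst (_∈ map (σ ⟨$⟩ʳ_) (allFin m)) (inverseʳ σ)
              (∈-map⁺ (σ ⟨$⟩ʳ_) (∈-allFin (σ ⟨$⟩ˡ i))))))

concatᶠ-↭ : ∀ {A : Set} {m} (σ : Permutation′ m) (B : Fin m → List A) →
  concatᶠ (B ∘ (σ ⟨$⟩ʳ_)) ↭ concatᶠ B
concatᶠ-↭ {m = m} σ B = subst₂ _↭_
  (trans (cong concat (sym (map-∘ (allFin m)))) (concatMap-allFin (B ∘ (σ ⟨$⟩ʳ_))))
  (concatMap-allFin B)
  (concat-↭ (map⁺ B (allFin-↭ σ)))

blocks : ∀ {A : Set} m → (Fin m → ℕ) → List A → Fin m → List A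
blocks (suc m) len w zero    = take (len zero) w
blocks (suc m) len w (suc i) = blocks m (len ∘ suc) (drop (len zero) w) i

rest : ∀ {A : Set} m → (Fin m → ℕ) → List A → List A
rest zero    len w = w
rest (suc m) len w = rest m (len ∘ suc) (drop (len zero) w)

concatᶠ-blocks-++-rest : ∀ {A : Set} m len (w : List A) → concatᶠ (blocks m len w) ++ rest m len w ≡ w
concatᶠ-blocks-++-rest zero    len w = refl
concatᶠ-blocks-++-rest (suc m) len w = begin
  (take k w ++ concatᶠ (blocks m (len ∘ suc) (drop k w))) ++ rest m (len ∘ suc) (drop k w)
    ≡⟨ ++-assoc (take k w) _ _ ⟩
  take k w ++ (concatᶠ (blocks m (len ∘ suc) (drop k w)) ++ rest m (len ∘ suc) (drop k w))
    ≡⟨ cong (take k w ++_) (concatᶠ-blocks-++-rest m (len ∘ suc) (drop k w)) ⟩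
  take k w ++ drop k w
    ≡⟨ take++drop≡id k w ⟩
  w ∎
  where
  open ≡-Reasoning
  k : ℕ
  k = len zero

take-prefix : ∀ {A : Set} {k} (u v : List A) → length u ≡ k → take k (u ++ v) ≡ u
take-prefix []      v refl = refl
take-prefix (x ∷ u) v refl = cong (x ∷_) (take-prefix u v refl)

drop-prefix : ∀ {A : Set} {k} (u v : List A) → length u ≡ k → drop k (u ++ v) ≡ v
drop-prefix []      v refl = refl
drop-prefix (x ∷ u) v refl = drop-prefix u v refl

blocks-of-concatᶠ : ∀ {A : Set} m len (B : Fin m → List A) r → (∀ i → length (B i) ≡ len i) →
  ∀ i → blocks m len (concatᶠ B ++ r) i ≡ B i
blocks-of-concatᶠ (suc m) len B r l zero =
  trans (cong (take (len zero)) (++-assoc (B zero) _ _)) (take-prefix (B zero) _ (l zero))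
blocks-of-concatᶠ (suc m) len B r l (suc i) =
  trans (cong (λ z → blocks m (len ∘ suc) z i)
           (trans (cong (drop (len zero)) (++-assoc (B zero) _ _)) (drop-prefix (B zero) _ (l zero))))
        (blocks-of-concatᶠ m (len ∘ suc) (B ∘ suc) r (l ∘ suc) i)

rest-of-concatᶠ : ∀ {A : Set} m len (B : Fin m → List A) r → (∀ i → length (B i) ≡ len i) →
  rest m len (concatᶠ B ++ r) ≡ r
rest-of-concatᶠ zero    len B r l = refl
rest-of-concatᶠ (suc m) len B r l =
  trans (cong (rest m (len ∘ suc))
           (trans (cong (drop (len zero)) (++-assoc (B zero) _ _)) (drop-prefix (B zero) _ (l zero))))
        (rest-of-concatᶠ m (len ∘ suc) (B ∘ suc) r (l ∘ suc))

length-take-prefix : ∀ {A : Set} k (w : List A) L → length w ≡ k + L → length (take k w) ≡ k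
length-take-prefix k w L e = trans (length-take k w) (m≤n⇒m⊓n≡m (subst (k ≤_) (sym e) (m≤m+n k L)))

length-drop-prefix : ∀ {A : Set} k (w : List A) L → length w ≡ k + L → length (drop k w) ≡ L
length-drop-prefix k w L e = trans (length-drop k w) (trans (cong (_∸ k) e) (m+n∸m≡n k L))

blocks-lengths : ∀ {A B : Set} m (T : Fin m → List B) (Tk : List B) (w : List A) →
  length w ≡ length (concatᶠ T ++ Tk) →
  (∀ i → length (blocks m (length ∘ T) w i) ≡ length (T i)) × length (rest m (length ∘ T) w) ≡ length Tk
blocks-lengths zero    T Tk w e = (λ ()) , e
blocks-lengths {A} (suc m) T Tk w e = lengths , proj₂ ih
  where
  e′ : length w ≡ length (T zero) + length (concatᶠ (T ∘ suc) ++ Tk)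
  e′ = trans e (trans (cong length (++-assoc (T zero) _ _)) (length-++ (T zero)))
  w′ : List A
  w′ = drop (length (T zero)) w
  ih : (∀ i → length (blocks m (length ∘ T ∘ suc) w′ i) ≡ length (T (suc i)))
     × length (rest m (length ∘ T ∘ suc) w′) ≡ length Tk
  ih = blocks-lengths m (T ∘ suc) Tk w′ (length-drop-prefix _ w _ e′)
  lengths : ∀ i → length (blocks (suc m) (length ∘ T) w i) ≡ length (T i)
  lengths zero    = length-take-prefix _ w _ e′
  lengths (suc i) = proj₁ ih i

Opens-concatᶠ : ∀ m (T : Fin m → List Bool) Tk → (∀ i → Opens (T i)) → Opens Tk → Opens (concatᶠ T ++ Tk)
Opens-concatᶠ zero    T Tk oT oTk = oTk
Opens-concatᶠ (suc m) T Tk oT oTk = subst Opens (sym (++-assoc (T zero) _ _)) (Opens-++ (T zero) _ (oT zero))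

indicator-split-blocks : ∀ m (W : Fin m → List ℕ) (T : Fin m → List Bool) Wk Tk →
  (∀ i → length (W i) ≡ length (T i)) → (∀ i → Opens (T i)) → (∀ i → Closes (T i)) → Opens Tk →
  indicator (concatᶠ W ++ Wk) ≡ concatᶠ T ++ Tk → (∀ i → indicator (W i) ≡ T i) × indicator Wk ≡ Tk
indicator-split-blocks zero    W T Wk Tk l oT cT oTk e = (λ ()) , e
indicator-split-blocks (suc m) W T Wk Tk l oT cT oTk e = pieces , proj₂ ih
  where
  first : indicator (W zero) ≡ T zero × indicator (concatᶠ (W ∘ suc) ++ Wk) ≡ concatᶠ (T ∘ suc) ++ Tk
  first = indicator-split (W zero) _ (T zero) _ (l zero) (cT zero) (Opens-concatᶠ m (T ∘ suc) Tk (oT ∘ suc) oTk)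
    (trans (cong indicator (sym (++-assoc (W zero) _ _))) (trans e (++-assoc (T zero) _ _)))
  ih : (∀ i → indicator (W (suc i)) ≡ T (suc i)) × indicator Wk ≡ Tk
  ih = indicator-split-blocks m (W ∘ suc) (T ∘ suc) Wk Tk (l ∘ suc) (oT ∘ suc) (cT ∘ suc) oTk (proj₂ first)
  pieces : ∀ i → indicator (W i) ≡ T i
  pieces zero    = proj₁ first
  pieces (suc i) = proj₁ ih i

indicator-join-blocks : ∀ m (W : Fin m → List ℕ) (T : Fin m → List Bool) Wk Tk →
  (∀ i → indicator (W i) ≡ T i) → indicator Wk ≡ Tk →
  (∀ i → Opens (T i)) → (∀ i → Closes (T i)) → Opens Tk →
  indicator (concatᶠ W ++ Wk) ≡ concatᶠ T ++ Tk
indicator-join-blocks zero    W T Wk Tk e ek oT cT oTk = ek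
indicator-join-blocks (suc m) W T Wk Tk e ek oT cT oTk = begin
  indicator ((W zero ++ concatᶠ (W ∘ suc)) ++ Wk)
    ≡⟨ cong indicator (++-assoc (W zero) _ _) ⟩
  indicator (W zero ++ (concatᶠ (W ∘ suc) ++ Wk))
    ≡⟨ indicator-join (W zero) _ (subst Closes (sym (e zero)) (cT zero))
         (subst Opens (sym ih) (Opens-concatᶠ m (T ∘ suc) Tk (oT ∘ suc) oTk)) ⟩
  indicator (W zero) ++ indicator (concatᶠ (W ∘ suc) ++ Wk)
    ≡⟨ cong₂ _++_ (e zero) ih ⟩
  T zero ++ (concatᶠ (T ∘ suc) ++ Tk)
    ≡⟨ ++-assoc (T zero) _ _ ⟨
  (T zero ++ concatᶠ (T ∘ suc)) ++ Tk ∎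
  where
  open ≡-Reasoning
  ih : indicator (concatᶠ (W ∘ suc) ++ Wk) ≡ concatᶠ (T ∘ suc) ++ Tk
  ih = indicator-join-blocks m (W ∘ suc) (T ∘ suc) Wk Tk (e ∘ suc) ek (oT ∘ suc) (cT ∘ suc) oTk

record BlockPattern (m : ℕ) : Set where
  field
    initial        : List Bool
    block          : Fin m → List Bool
    final          : List Bool
    initial-closes : Closes initial
    block-opens    : ∀ i → Opens (block i)
    block-closes   : ∀ i → Closes (block i)
    final-opens    : Opens final

flatten : ∀ {m} → BlockPattern m → List Bool
flatten t = initial ++ (concatᶠ block ++ final)
  where open BlockPattern t

permuteBlocks : ∀ {m} → BlockPattern m → (Fin m → Fin m) → BlockPattern m
permuteBlocks t τ = record
  { initial = initial ; block = block ∘ τ ; final = final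
  ; initial-closes = initial-closes ; block-opens = block-opens ∘ τ
  ; block-closes = block-closes ∘ τ ; final-opens = final-opens }
  where open BlockPattern t

rearrange : ∀ m → ℕ → (Fin m → ℕ) → (Fin m → Fin m) → List ℕ → List ℕ
rearrange m l₀ len τ w = take l₀ w ++ (concatᶠ (blocks m len (drop l₀ w) ∘ τ) ++ rest m len (drop l₀ w))

rearrange-↭ : ∀ m l₀ len (σ : Permutation′ m) w → rearrange m l₀ len (σ ⟨$⟩ʳ_) w ↭ w
rearrange-↭ m l₀ len σ w = subst (rearrange m l₀ len (σ ⟨$⟩ʳ_) w ↭_)
  (trans (cong (take l₀ w ++_) (concatᶠ-blocks-++-rest m len (drop l₀ w))) (take++drop≡id l₀ w))
  (++⁺ˡ (take l₀ w) (++⁺ʳ (rest m len (drop l₀ w)) (concatᶠ-↭ σ (blocks m len (drop l₀ w)))))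

module Rearrangement {m} (t : BlockPattern m) (w : List ℕ) (w-fits : indicator w ≡ flatten t) where
  open BlockPattern t

  l₀ : ℕ
  l₀ = length initial

  len : Fin m → ℕ
  len = length ∘ block

  private
    W₀ v Wk : List ℕ
    W₀ = take l₀ w
    v  = drop l₀ w
    Wk = rest m len v

    W : Fin m → List ℕ
    W = blocks m len v

    length-w : length w ≡ l₀ + length (concatᶠ block ++ final)
    length-w = trans (sym (length-indicator w)) (trans (cong length w-fits) (length-++ initial))

    length-W₀ : length W₀ ≡ l₀
    length-W₀ = length-take-prefix l₀ w _ length-w

    lengths : (∀ i → length (W i) ≡ length (block i)) × length Wk ≡ length final
    lengths = blocks-lengths m block final v (length-drop-prefix l₀ w _ length-w)

    initial-piece : indicator W₀ ≡ initial × indicator v ≡ concatᶠ block ++ final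
    initial-piece = indicator-split W₀ v initial (concatᶠ block ++ final) length-W₀ initial-closes
      (Opens-concatᶠ m block final block-opens final-opens) (trans (cong indicator (take++drop≡id l₀ w)) w-fits)

    pieces : (∀ i → indicator (W i) ≡ block i) × indicator Wk ≡ final
    pieces = indicator-split-blocks m W block Wk final (proj₁ lengths) block-opens block-closes final-opens
      (trans (cong indicator (concatᶠ-blocks-++-rest m len v)) (proj₂ initial-piece))

  rearrange-fits : ∀ τ → indicator (rearrange m l₀ len τ w) ≡ flatten (permuteBlocks t τ)
  rearrange-fits τ = begin
    indicator (W₀ ++ (concatᶠ (W ∘ τ) ++ Wk))
      ≡⟨ indicator-join W₀ _ (subst Closes (sym (proj₁ initial-piece)) initial-closes)
           (subst Opens (sym middle) (Opens-concatᶠ m (block ∘ τ) final (block-opens ∘ τ) final-opens)) ⟩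
    indicator W₀ ++ indicator (concatᶠ (W ∘ τ) ++ Wk)
      ≡⟨ cong₂ _++_ (proj₁ initial-piece) middle ⟩
    initial ++ (concatᶠ (block ∘ τ) ++ final) ∎
    where
    open ≡-Reasoning
    middle : indicator (concatᶠ (W ∘ τ) ++ Wk) ≡ concatᶠ (block ∘ τ) ++ final
    middle = indicator-join-blocks m (W ∘ τ) (block ∘ τ) Wk final (proj₁ pieces ∘ τ) (proj₂ pieces)
      (block-opens ∘ τ) (block-closes ∘ τ) final-opens

  rearrange-inverse : ∀ τ τ′ len′ → (∀ i → len′ i ≡ len (τ i)) → (∀ i → τ (τ′ i) ≡ i) →
    rearrange m l₀ len′ τ′ (rearrange m l₀ len τ w) ≡ w
  rearrange-inverse τ τ′ len′ len′≡ τ∘τ′ = begin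
    take l₀ (W₀ ++ Y)
      ++ (concatᶠ (blocks m len′ (drop l₀ (W₀ ++ Y)) ∘ τ′) ++ rest m len′ (drop l₀ (W₀ ++ Y)))
      ≡⟨ cong₂ (λ a b → a ++ (concatᶠ (blocks m len′ b ∘ τ′) ++ rest m len′ b))
           (take-prefix W₀ Y length-W₀) (drop-prefix W₀ Y length-W₀) ⟩
    W₀ ++ (concatᶠ (blocks m len′ Y ∘ τ′) ++ rest m len′ Y)
      ≡⟨ cong (W₀ ++_) (cong₂ _++_
           (concatᶠ-cong (λ i → trans (blocks-of-concatᶠ m len′ (W ∘ τ) Wk lengths-τ (τ′ i))
                                      (cong W (τ∘τ′ i))))
           (rest-of-concatᶠ m len′ (W ∘ τ) Wk lengths-τ)) ⟩
    W₀ ++ (concatᶠ W ++ Wk)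
      ≡⟨ cong (W₀ ++_) (concatᶠ-blocks-++-rest m len v) ⟩
    W₀ ++ v
      ≡⟨ take++drop≡id l₀ w ⟩
    w ∎
    where
    open ≡-Reasoning
    Y : List ℕ
    Y = concatᶠ (W ∘ τ) ++ Wk
    lengths-τ : ∀ i → length (W (τ i)) ≡ len′ i
    lengths-τ i = trans (proj₁ lengths (τ i)) (sym (len′≡ i))

unique-bijection⇒length≡ : ∀ {A : Set} (xs ys : List A) → Unique xs → Unique ys → (f g : A → A) →
  (∀ {x} → x ∈ xs → f x ∈ ys) → (∀ {y} → y ∈ ys → g y ∈ xs) →
  (∀ {x} → x ∈ xs → g (f x) ≡ x) → (∀ {y} → y ∈ ys → f (g y) ≡ y) → length xs ≡ length ys
unique-bijection⇒length≡ xs ys uxs uys f g f∈ g∈ gf fg =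
  trans (sym (length-map f xs)) (↭-length (↭-sym ys↭fxs))
  where
  -- f is injective on xs, so it does not create repetitions.
  unique-map : ∀ xs → (∀ {x} → x ∈ xs → g (f x) ≡ x) → Unique xs → Unique (map f xs)
  unique-map []       _  []          = []
  unique-map (x ∷ xs) gf (x∉ ∷ uxs) =
    AllProps.map⁺ (All.tabulate (λ {x′} x′∈ fx≡ → All.lookup x∉ x′∈
      (trans (sym (gf (here refl))) (trans (cong g fx≡) (gf (there x′∈))))))
    ∷ unique-map xs (gf ∘ there) uxs
  ys↭fxs : ys ↭ map f xs
  ys↭fxs = ∼bag⇒↭ (unique∧set⇒bag uys (unique-map xs gf uxs)
    (mk⇔ (λ y∈ → subst (_∈ map f xs) (fg y∈) (∈-map⁺ f (g∈ y∈)))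
         (λ fx∈ → let x , x∈ , e = ∈-map⁻ f fx∈ in subst (_∈ ys) (sym e) (f∈ x∈))))

letters : ℕ → List ℕ
letters n = map suc (upTo n)

words-sound : ∀ n l w → w ∈ words n l → length w ≡ l × All (_∈ letters n) w
words-sound n zero    .[] (here refl) = refl , []
words-sound n (suc l) w   w∈
  with xs , w∈xs , xs∈ ← ∈-concat⁻′ (map (λ x → map (x ∷_) (words n l)) (letters n)) w∈
  with x , x∈ , refl ← ∈-map⁻ (λ x → map (x ∷_) (words n l)) xs∈
  with w′ , w′∈ , refl ← ∈-map⁻ (x ∷_) w∈xs
  = let length≡ , all∈ = words-sound n l w′ w′∈ in cong suc length≡ , x∈ ∷ all∈

words-complete : ∀ n l w → length w ≡ l → All (_∈ letters n) w → w ∈ words n l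
words-complete n zero    []      refl []         = here refl
words-complete n (suc l) (x ∷ w) e    (x∈ ∷ all∈) =
  ∈-concat⁺′ (∈-map⁺ (x ∷_) (words-complete n l w (suc-injective e) all∈))
             (∈-map⁺ (λ x → map (x ∷_) (words n l)) x∈)

words-unique : ∀ n l → Unique (words n l)
words-unique n zero    = [] ∷ []
words-unique n (suc l) = subst Unique (sym (as-product (letters n)))
  (Unique.cartesianProductWith⁺ _∷_ ∷-injective (Unique.map⁺ suc-injective (Unique.upTo⁺ n)) (words-unique n l))
  where
  as-product : ∀ xs → concatMap (λ x → map (x ∷_) (words n l)) xs ≡ cartesianProductWith _∷_ xs (words n l)
  as-product []       = refl
  as-product (x ∷ xs) = cong (map (x ∷_) (words n l) ++_) (as-product xs)

record IsPermutation (n : ℕ) (w : List ℕ) : Set where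
  field
    unique  : Unique w
    length≡ : length w ≡ n
    in-range : All (_∈ letters n) w

∈perms⇒IsPermutation : ∀ n w → w ∈ perms n → IsPermutation n w
∈perms⇒IsPermutation n w w∈ =
  let w∈words , u = ∈-filter⁻ unique? w∈
      l , a = words-sound n n w w∈words
  in record { unique = u ; length≡ = l ; in-range = a }

IsPermutation⇒∈perms : ∀ n w → IsPermutation n w → w ∈ perms n
IsPermutation⇒∈perms n w p = ∈-filter⁺ unique? (words-complete n n w length≡ in-range) unique
  where open IsPermutation p

∈perms-resp-↭ : ∀ {n w w′} → w ↭ w′ → w ∈ perms n → w′ ∈ perms n
∈perms-resp-↭ {n} {w} {w′} p w∈ = IsPermutation⇒∈perms n w′ (record
  { unique  = Unique-resp-↭ (setoid ℕ) (↭⇒↭ₛ p) unique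
  ; length≡ = trans (sym (↭-length p)) length≡
  ; in-range = All-resp-↭ p in-range })
  where open IsPermutation (∈perms⇒IsPermutation n w w∈)

perms-unique : ∀ n → Unique (perms n)
perms-unique n = Unique.filter⁺ unique? (words-unique n n)

withIndicator : ℕ → List Bool → List (List ℕ)
withIndicator n T = filter (λ w → ≡-dec _≟ᵇ_ (indicator w) T) (perms n)

count : ℕ → List Bool → ℕ
count n T = length (withIndicator n T)

withIndicator-unique : ∀ n T → Unique (withIndicator n T)
withIndicator-unique n T = Unique.filter⁺ (λ w → ≡-dec _≟ᵇ_ (indicator w) T) (perms-unique n)

∈withIndicator⇒fits : ∀ {n T w} → w ∈ withIndicator n T → indicator w ≡ T
∈withIndicator⇒fits {n} {T} w∈ = proj₂ (∈-filter⁻ (λ w → ≡-dec _≟ᵇ_ (indicator w) T) {xs = perms n} w∈)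

rearrange-∈ : ∀ {m} n (t : BlockPattern m) (σ : Permutation′ m) {w} → w ∈ withIndicator n (flatten t) →
  rearrange m (length (BlockPattern.initial t)) (length ∘ BlockPattern.block t) (σ ⟨$⟩ʳ_) w
    ∈ withIndicator n (flatten (permuteBlocks t (σ ⟨$⟩ʳ_)))
rearrange-∈ {m} n t σ {w} w∈ =
  ∈-filter⁺ (λ w → ≡-dec _≟ᵇ_ (indicator w) (flatten (permuteBlocks t (σ ⟨$⟩ʳ_))))
    (∈perms-resp-↭ {n} (↭-sym (rearrange-↭ m (length initial) (length ∘ block) σ w)) w∈perms)
    (Rearrangement.rearrange-fits t w fits (σ ⟨$⟩ʳ_))
  where
  open BlockPattern t using (initial; block)
  w∈perms : w ∈ perms n
  w∈perms = proj₁ (∈-filter⁻ (λ w → ≡-dec _≟ᵇ_ (indicator w) (flatten t)) {xs = perms n} w∈)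
  fits : indicator w ≡ flatten t
  fits = ∈withIndicator⇒fits {n} w∈

-- Permuting the middle blocks of a block pattern does not change the number of
-- permutations following it: rearranging by σ and by σ⁻¹ are inverse bijections.
count-permuteBlocks : ∀ {m} n (t : BlockPattern m) (σ : Permutation′ m) →
  count n (flatten t) ≡ count n (flatten (permuteBlocks t (σ ⟨$⟩ʳ_)))
count-permuteBlocks {m} n t σ = unique-bijection⇒length≡
  (withIndicator n (flatten t)) (withIndicator n (flatten tσ))
  (withIndicator-unique n (flatten t)) (withIndicator-unique n (flatten tσ))
  F G (rearrange-∈ n t σ) G∈ GF FG
  where
  open BlockPattern t using (initial; block; final)
  tσ : BlockPattern m
  tσ = permuteBlocks t (σ ⟨$⟩ʳ_)
  len : Fin m → ℕ
  len = length ∘ block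
  F G : List ℕ → List ℕ
  F = rearrange m (length initial) len (σ ⟨$⟩ʳ_)
  G = rearrange m (length initial) (len ∘ (σ ⟨$⟩ʳ_)) (σ ⟨$⟩ˡ_)
  back : flatten (permuteBlocks tσ (σ ⟨$⟩ˡ_)) ≡ flatten t
  back = cong (λ B → initial ++ (B ++ final)) (concatᶠ-cong (λ i → cong block (inverseʳ σ {i})))
  G∈ : ∀ {w} → w ∈ withIndicator n (flatten tσ) → G w ∈ withIndicator n (flatten t)
  G∈ {w} w∈ = subst (λ T → G w ∈ withIndicator n T) back (rearrange-∈ n tσ (flip σ) w∈)
  GF : ∀ {w} → w ∈ withIndicator n (flatten t) → G (F w) ≡ w
  GF {w} w∈ = Rearrangement.rearrange-inverse t w (∈withIndicator⇒fits {n} w∈)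
    (σ ⟨$⟩ʳ_) (σ ⟨$⟩ˡ_) (len ∘ (σ ⟨$⟩ʳ_)) (λ _ → refl) (λ i → inverseʳ σ {i})
  FG : ∀ {w} → w ∈ withIndicator n (flatten tσ) → F (G w) ≡ w
  FG {w} w∈ = Rearrangement.rearrange-inverse tσ w (∈withIndicator⇒fits {n} w∈)
    (σ ⟨$⟩ˡ_) (σ ⟨$⟩ʳ_) len (λ i → cong len (sym (inverseʳ σ {i}))) (λ i → inverseˡ σ {i})

closedParts : List ℕ → List Bool
closedParts []      = []
closedParts (x ∷ r) = closedPart x ++ closedParts r

closedParts-++ : ∀ α β → closedParts (α ++ β) ≡ closedParts α ++ closedParts β
closedParts-++ []      β = refl
closedParts-++ (x ∷ α) β = trans (cong (closedPart x ++_) (closedParts-++ α β)) (sym (++-assoc (closedPart x) _ _))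

closedParts-concatᶠ : ∀ {m} (g : Fin m → List ℕ) → closedParts (concatᶠ g) ≡ concatᶠ (closedParts ∘ g)
closedParts-concatᶠ {zero}  g = refl
closedParts-concatᶠ {suc m} g =
  trans (closedParts-++ (g zero) _) (cong (closedParts (g zero) ++_) (closedParts-concatᶠ (g ∘ suc)))

closedParts-ends-with-peak : ∀ x r → Σ[ Y ∈ List Bool ] closedParts (x ∷ r) ≡ Y ++ true ∷ []
closedParts-ends-with-peak x []      = replicate (x ∸ 1) false , ++-identityʳ _
closedParts-ends-with-peak x (y ∷ r) =
  let Y , e = closedParts-ends-with-peak y r in
  closedPart x ++ Y , trans (cong (closedPart x ++_) e) (sym (++-assoc (closedPart x) Y _))

encode-∷ : ∀ x s → s ≢ [] → encode (x ∷ s) ≡ closedPart x ++ encode s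
encode-∷ x []      s≢[] = contradiction refl s≢[]
encode-∷ x (y ∷ s) _    = refl

encode-++ : ∀ α β → β ≢ [] → encode (α ++ β) ≡ closedParts α ++ encode β
encode-++ []      β _    = refl
encode-++ (x ∷ α) β β≢[] = begin
  encode (x ∷ α ++ β)                       ≡⟨ encode-∷ x (α ++ β) (β≢[] ∘ ++-conicalʳ α β) ⟩
  closedPart x ++ encode (α ++ β)           ≡⟨ cong (closedPart x ++_) (encode-++ α β β≢[]) ⟩
  closedPart x ++ closedParts α ++ encode β ≡⟨ ++-assoc (closedPart x) _ _ ⟨
  closedParts (x ∷ α) ++ encode β           ∎
  where open ≡-Reasoning

-- The part (3) between two compositions is encoded false, false, true; the
-- junction is cut between its first two letters, giving the blocks below.
chainBlock : List ℕ → List Bool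
chainBlock c = false ∷ true ∷ (closedParts c ++ false ∷ [])

closes-after-closedParts : ∀ c → Closes (closedParts c ++ false ∷ [])
closes-after-closedParts []      = inj₁ refl
closes-after-closedParts (x ∷ r) = let Y , e = closedParts-ends-with-peak x r in
  inj₂ (Y , trans (cong (_++ false ∷ []) e) (++-assoc Y (true ∷ []) (false ∷ [])))

chainBlock-closes : ∀ c → Closes (chainBlock c)
chainBlock-closes c with closes-after-closedParts c
... | inj₁ e       = inj₂ (false ∷ [] , cong (λ X → false ∷ true ∷ X) e)
... | inj₂ (Y , e) = inj₂ (false ∷ true ∷ Y , cong (λ X → false ∷ true ∷ X) e)

chainPattern : ∀ {m} → List ℕ → (Fin m → List ℕ) → List ℕ → BlockPattern m
chainPattern c₀ f c_k = record
  { initial = closedParts c₀ ++ false ∷ [] ; block = chainBlock ∘ f ; final = false ∷ true ∷ encode c_k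
  ; initial-closes = closes-after-closedParts c₀
  ; block-opens = λ i → _ , refl ; block-closes = chainBlock-closes ∘ f ; final-opens = _ , refl }

encode-chain : ∀ {m} c₀ (f : Fin m → List ℕ) c_k → c_k ≢ [] →
  encode (chain c₀ f c_k) ≡ flatten (chainPattern c₀ f c_k)
encode-chain {m} c₀ f c_k c_k≢[] = begin
  encode (c₀ ++ (concatMap (λ i → 3 ∷ f i) (allFin m) ++ 3 ∷ c_k))
    ≡⟨ cong (λ z → encode (c₀ ++ (z ++ 3 ∷ c_k))) (concatMap-allFin (λ i → 3 ∷ f i)) ⟩
  encode (c₀ ++ (concatᶠ (λ i → 3 ∷ f i) ++ 3 ∷ c_k))
    ≡⟨ encode-++ c₀ _ ((λ ()) ∘ ++-conicalʳ (concatᶠ (λ i → 3 ∷ f i)) _) ⟩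
  closedParts c₀ ++ encode (concatᶠ (λ i → 3 ∷ f i) ++ 3 ∷ c_k)
    ≡⟨ cong (closedParts c₀ ++_) (encode-++ (concatᶠ (λ i → 3 ∷ f i)) _ (λ ())) ⟩
  closedParts c₀ ++ (closedParts (concatᶠ (λ i → 3 ∷ f i)) ++ encode (3 ∷ c_k))
    ≡⟨ cong₂ (λ a b → closedParts c₀ ++ (a ++ b))
         (closedParts-concatᶠ (λ i → 3 ∷ f i)) (encode-∷ 3 c_k c_k≢[]) ⟩
  closedParts c₀ ++ (concatᶠ (λ i → false ∷ chainOpening (f i)) ++ false ∷ false ∷ true ∷ encode c_k)
    ≡⟨ cong (closedParts c₀ ++_) (shift-separator (chainOpening ∘ f) _) ⟩
  closedParts c₀ ++ false ∷ (concatᶠ (chainBlock ∘ f) ++ false ∷ true ∷ encode c_k)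
    ≡⟨ ++-assoc (closedParts c₀) (false ∷ []) _ ⟨
  flatten (chainPattern c₀ f c_k) ∎
  where
  open ≡-Reasoning
  chainOpening : List ℕ → List Bool
  chainOpening c = false ∷ true ∷ closedParts c
  shift-separator : ∀ {m} (g : Fin m → List Bool) Y →
    concatᶠ (λ i → false ∷ g i) ++ false ∷ Y ≡ false ∷ (concatᶠ (λ i → g i ++ false ∷ []) ++ Y)
  shift-separator {zero}  g Y = refl
  shift-separator {suc m} g Y = cong (false ∷_) (begin
    (g zero ++ concatᶠ (λ i → false ∷ g (suc i))) ++ false ∷ Y
      ≡⟨ ++-assoc (g zero) _ _ ⟩
    g zero ++ (concatᶠ (λ i → false ∷ g (suc i)) ++ false ∷ Y)
      ≡⟨ cong (g zero ++_) (shift-separator (g ∘ suc) Y) ⟩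
    g zero ++ false ∷ (concatᶠ (λ i → g (suc i) ++ false ∷ []) ++ Y)
      ≡⟨ ++-assoc (g zero) (false ∷ []) _ ⟨
    (g zero ++ false ∷ []) ++ (concatᶠ (λ i → g (suc i) ++ false ∷ []) ++ Y)
      ≡⟨ ++-assoc (g zero ++ false ∷ []) _ _ ⟨
    ((g zero ++ false ∷ []) ++ concatᶠ (λ i → g (suc i) ++ false ∷ [])) ++ Y ∎)

All-concatᶠ : ∀ {m} {Q : ℕ → Set} (g : Fin m → List ℕ) → (∀ i → All Q (g i)) → All Q (concatᶠ g)
All-concatᶠ {zero}  g a = []
All-concatᶠ {suc m} g a = AllProps.++⁺ (a zero) (All-concatᶠ (g ∘ suc) (a ∘ suc))

chain-isComposition : ∀ {m} c₀ (f : Fin m → List ℕ) c_k → IsComposition c₀ → (∀ i → IsComposition (f i)) →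
  IsComposition c_k → IsComposition (chain c₀ f c_k)
chain-isComposition c₀ f c_k pos₀ posᶠ posₖ = AllProps.++⁺ pos₀ (AllProps.++⁺
  (subst IsComposition (sym (concatMap-allFin (λ i → 3 ∷ f i)))
     (All-concatᶠ (λ i → 3 ∷ f i) (λ i → s≤s z≤n ∷ posᶠ i)))
  (s≤s z≤n ∷ posₖ))

chain-nonempty : ∀ {m} c₀ (f : Fin m → List ℕ) c_k → chain c₀ f c_k ≢ []
chain-nonempty {m} c₀ f c_k e with ++-conicalʳ (concatMap (λ i → 3 ∷ f i) (allFin m)) _ (++-conicalʳ c₀ _ e)
... | ()

chain-↭ : ∀ {m} c₀ (f : Fin m → List ℕ) c_k (σ : Permutation′ m) →
  chain c₀ (f ∘ (σ ⟨$⟩ʳ_)) c_k ↭ chain c₀ f c_k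
chain-↭ {m} c₀ f c_k σ = subst₂ (λ a b → c₀ ++ (a ++ 3 ∷ c_k) ↭ c₀ ++ (b ++ 3 ∷ c_k))
  (sym (concatMap-allFin (λ i → 3 ∷ f (σ ⟨$⟩ʳ i)))) (sym (concatMap-allFin (λ i → 3 ∷ f i)))
  (++⁺ˡ c₀ (++⁺ʳ (3 ∷ c_k) (concatᶠ-↭ σ (λ i → 3 ∷ f i))))

P≡count : ∀ c → IsComposition c → c ≢ [] → P c ≡ count (sum c) (encode c)
P≡count c pos c≢[] = cong length (filter-≐
  (λ w → ≡-dec _≟_ (peakComp w) c) (λ w → ≡-dec _≟ᵇ_ (indicator w) (encode c))
  ((λ {w} → Equivalence.to (same w)) , (λ {w} → Equivalence.from (same w)))
  (perms (sum c)))
  where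
  same : ∀ w → (peakComp w ≡ c) ⇔ (indicator w ≡ encode c)
  same w = peakComp≡⇔indicator≡ w c pos c≢[]

P-chain-permute : ∀ {m} c₀ (f : Fin m → List ℕ) c_k → IsComposition c₀ → (∀ i → IsComposition (f i)) →
  IsComposition c_k → c_k ≢ [] → (σ : Permutation′ m) →
  P (chain c₀ f c_k) ≡ P (chain c₀ (f ∘ (σ ⟨$⟩ʳ_)) c_k)
P-chain-permute {m} c₀ f c_k pos₀ posᶠ posₖ c_k≢[] σ = begin
  P c                                        ≡⟨ P≡count c (isComposition f posᶠ) (chain-nonempty c₀ f c_k) ⟩
  count n (encode c)                         ≡⟨ cong (count n) (encode-chain c₀ f c_k c_k≢[]) ⟩
  count n (flatten (chainPattern c₀ f c_k))  ≡⟨ count-permuteBlocks n (chainPattern c₀ f c_k) σ ⟩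
  count n (flatten (chainPattern c₀ fσ c_k)) ≡⟨ cong (count n) (encode-chain c₀ fσ c_k c_k≢[]) ⟨
  count n (encode cσ)                        ≡⟨ cong (λ k → count k (encode cσ)) (sum-↭ (chain-↭ c₀ f c_k σ)) ⟨
  count (sum cσ) (encode cσ)                 ≡⟨ P≡count cσ (isComposition fσ (posᶠ ∘ (σ ⟨$⟩ʳ_))) (chain-nonempty c₀ fσ c_k) ⟨
  P cσ                                       ∎
  where
  open ≡-Reasoning
  fσ : Fin m → List ℕ
  fσ = f ∘ (σ ⟨$⟩ʳ_)
  c cσ : List ℕ
  c  = chain c₀ f c_k
  cσ = chain c₀ fσ c_k
  n : ℕ
  n  = sum c
  isComposition : ∀ g → (∀ i → IsComposition (g i)) → IsComposition (chain c₀ g c_k)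
  isComposition g posᵍ = chain-isComposition c₀ g c_k pos₀ posᵍ posₖ

proposition6p1 : (m : ℕ) (c : Fin (suc (suc m)) → List ℕ)
    → (∀ i → IsComposition (c i))
    → c (fromℕ (suc m)) ≢ []
    → (σ : Permutation′ m)
    → P (chain (c zero) (λ i → c (suc (inject₁ i))) (c (fromℕ (suc m))))
      ≡ P (chain (c zero) (λ i → c (suc (inject₁ (σ ⟨$⟩ʳ i)))) (c (fromℕ (suc m))))
proposition6p1 m c pos c_k≢[] σ =
  P-chain-permute (c zero) (c ∘ suc ∘ inject₁) (c (fromℕ (suc m)))
    (pos zero) (pos ∘ suc ∘ inject₁) (pos _) c_k≢[] σ
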